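{- Let $k \ge 1$, $m \ge 1$ and $n > k+1$. Then for all positive integers $n_1, n_2$ with $n_1 + n_2 = n$ and $n_2 \equiv 0 \pmod{k+1}$, $$d_k(P_m \Box P_n) \le d_k(P_m \Box P_{n_1}) + d_k(P_m \Box P_{n_2}).$$
   Context: $P_n$ is the path on $n$ vertices ($P_1$ a single vertex); $P_m \Box P_n$ is the Cartesian product ($m\times n$ grid): vertices $(i,j)$, $0\le i\le m-1$, $0\le j\le n-1$, with $(i,j)$ adjacent to $(i',j')$ iff ($|i-i'|=1$ and $j=j'$) or ($i=i'$ and $|j-j'|=1$). The $k$-move deduction game ($k$ a positive integer) on a finite graph $G$: a layout places a finite number of searchers on vertices of $G$ (several searchers may share a vertex). Every searcher is initially mobile. A vertex is protected once it has been occupied by some searcher (so initially occupied vertices are protected); other vertices are unprotected. The game proceeds in stages. At each stage, for every vertex $v$ that has at least one unprotected neighbour: if the number of mobile searchers on $v$ is at least the number of unprotected neighbours of $v$, then the mobile searchers on $v$ move to the unprotected neighbours of $v$ so that each unprotected neighbour receives at least one searcher; excess mobile searchers on $v$ may also move to any of these unprotected neighbours. All moves in a stage happen simultaneously, newly occupied vertices become protected, and a searcher that has moved $k$ times becomes immobile. The process repeats until all vertices are protected or no searcher can move. A layout is successful if all vertices of $G$ end up protected. The $k$-move deduction number $d_k(G)$ is the minimum number of searchers in a successful layout on $G$. -}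

module Defs where

open import Data.Bool using (Bool; true; false; _∧_; _∨_; not; if_then_else_; T)
open import Data.Nat using (ℕ; zero; suc; _+_; _≤_; _<ᵇ_; _≤ᵇ_; _≡ᵇ_)
open import Data.Fin using (Fin; toℕ) renaming (_≟_ to _≟F_)
import Data.Fin as F
open import Data.List using (List; length; filterᵇ; cartesianProduct; null)
open import Data.List.Base using (allFin)
open import Data.Product using (Σ; _×_; _,_; ∃)
open import Data.Product.Properties using (≡-dec)
open import Relation.Nullary using (¬_)
open import Relation.Nullary.Decidable using (⌊_⌋)
open import Relation.Binary.Definitions using (DecidableEquality)
open import Relation.Binary.PropositionalEquality using (_≡_)
open import Relation.Binary.Construct.Closure.ReflexiveTransitive using (Star)

-- A finite graph: vertex type with decidable equality, a list enumerating
-- all vertices (each exactly once), and a Boolean symmetric adjacency relation.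
record Graph : Set₁ where
  field
    V     : Set
    _≟V_  : DecidableEquality V
    verts : List V
    adj   : V → V → Bool

count : ∀ {s} → (Fin s → Bool) → ℕ
count {zero}  f = 0
count {suc s} f = (if f F.zero then 1 else 0) + count (λ i → f (F.suc i))

someFin : ∀ {s} → (Fin s → Bool) → Bool
someFin f = 1 ≤ᵇ count f

module Game (G : Graph) (k : ℕ) where
  open Graph G

  eqV : V → V → Bool
  eqV u v = ⌊ u ≟V v ⌋

  record Config (s : ℕ) : Set where
    constructor config
    field
      pos  : Fin s → V
      cnt  : Fin s → ℕ
      prot : V → Bool
  open Config public

  module _ {s : ℕ} (c : Config s) where
    mobile : Fin s → Bool
    mobile i = cnt c i <ᵇ k

    unprotNbrs : V → List V
    unprotNbrs v = filterᵇ (λ u → adj v u ∧ not (prot c u)) verts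

    mobileAt : V → ℕ
    mobileAt v = count (λ i → eqV (pos c i) v ∧ mobile i)

    fires : V → Bool
    fires v = not (null (unprotNbrs v)) ∧ (length (unprotNbrs v) ≤ᵇ mobileAt v)

    moves : Fin s → Bool
    moves i = mobile i ∧ fires (pos c i)

  -- one stage of the game (nondeterministic in the distribution of excess searchers)
  record Step {s : ℕ} (c c' : Config s) : Set where
    field
      moveOK : ∀ i → T (moves c i) →
               (adj (pos c i) (pos c' i) ≡ true) × (prot c (pos c' i) ≡ false)
               × (cnt c' i ≡ suc (cnt c i))
      stayOK : ∀ i → ¬ T (moves c i) → (pos c' i ≡ pos c i) × (cnt c' i ≡ cnt c i)
      cover  : ∀ v u → T (fires c v) → adj v u ≡ true → prot c u ≡ false →
               ∃ λ i → (pos c i ≡ v) × T (mobile c i) × (pos c' i ≡ u)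
      protOK : ∀ u → prot c' u ≡ (prot c u ∨ someFin (λ i → eqV (pos c' i) u))

  initial : ∀ {s} → (Fin s → V) → Config s
  initial L = config L (λ _ → 0) (λ u → someFin (λ i → eqV (L i) u))

  Successful : ∀ {s} → (Fin s → V) → Set
  Successful {s} L = ∃ λ (c : Config s) → Star Step (initial L) c × (∀ v → prot c v ≡ true)

  IsDeductionNumber : ℕ → Set
  IsDeductionNumber d =
    (Σ (Fin d → V) Successful) × (∀ s (L : Fin s → V) → Successful L → d ≤ s)

adj1 : ℕ → ℕ → Bool
adj1 a b = (suc a ≡ᵇ b) ∨ (suc b ≡ᵇ a)

grid : ℕ → ℕ → Graph
grid m n = record
  { V     = Fin m × Fin n
  ; _≟V_  = ≡-dec _≟F_ _≟F_
  ; verts = cartesianProduct (allFin m) (allFin n)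
  ; adj   = λ { (i , j) (i' , j') →
              (adj1 (toℕ i) (toℕ i') ∧ (toℕ j ≡ᵇ toℕ j'))
              ∨ ((toℕ i ≡ᵇ toℕ i') ∧ adj1 (toℕ j) (toℕ j')) }
  }

dk≡ : ℕ → Graph → ℕ → Set
dk≡ k G d = Game.IsDeductionNumber G k d

{-# OPTIONS --safe #-}
module Submission where

-- Each searcher protects at most k + 1 vertices (its starting vertex and one per move), so every
-- successful layout on P_m □ P_{n₂} has at least m n₂ / (k + 1) searchers.  Conversely, write
-- n₂ = q (k + 1) and see P_m □ P_n as P_m □ P_{n₁} followed by q blocks of k + 1 columns.  Play an
-- optimal layout of P_m □ P_{n₁} on the first n₁ columns and put one extra searcher on the first
-- column of every block in every row.  Column n₁ is occupied from the start, so the game on the first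
-- n₁ columns runs exactly as on P_m □ P_{n₁}.  Each extra searcher waits until the column to its left
-- is protected and then walks k steps to the right through its block; the rows progress at their own
-- pace, but a least advanced row can always move.  Hence d ≤ d₁ + m q ≤ d₁ + d₂.

open import Defs
open import Data.Bool using (Bool; true; false; _∧_; _∨_; not; if_then_else_; T)
open import Data.Bool.Properties using (∧-zeroʳ; ∨-zeroʳ; ∨-identityʳ; T-≡; T-not-≡; T-∨; T?)
open import Data.Nat using (ℕ; zero; suc; _+_; _*_; _∸_; _⊓_; _≤_; _<_; _≤?_; _<?_; _≟_; _<ᵇ_; _≤ᵇ_; _≡ᵇ_; z≤n; s≤s)
open import Data.Nat.Properties
open import Data.Fin using (Fin; toℕ; fromℕ; fromℕ<; _↑ˡ_; _↑ʳ_; splitAt; combine; remQuot) renaming (zero to fzero; suc to fsuc)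
open import Data.Fin.Properties
  using (toℕ-injective; toℕ-↑ˡ; toℕ-↑ʳ; toℕ-fromℕ; toℕ-fromℕ<; toℕ<n; splitAt-↑ˡ; splitAt-↑ʳ; splitAt⁻¹-↑ˡ; splitAt⁻¹-↑ʳ;
         remQuot-combine; combine-remQuot; toℕ-combine; combine-injective; ↑ʳ-injective; ↑ˡ-injective; injective⇒≤)
import Data.Fin.Properties as Fin
open import Data.List using (List; []; _∷_; length; filterᵇ; cartesianProduct; null; map; _++_; allFin; tabulate)
open import Data.List.Membership.Propositional using (_∈_)
open import Data.List.Membership.Propositional.Properties using (∈-cartesianProduct⁺; ∈-allFin)
open import Data.List.Relation.Unary.All as All using (All; []; _∷_)
open import Data.List.Relation.Unary.Any as Any using (here; there)
open import Data.List.Properties using (filter-≐; filter-none; filter-some; filter-++; length-++; map-cong)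
open import Data.List.Relation.Unary.AllPairs using ([]; _∷_)
open import Data.List.Relation.Unary.Unique.Propositional using (Unique)
open import Data.List.Relation.Unary.Unique.Propositional.Properties using (cartesianProduct⁺; allFin⁺)
open import Data.Nat.ListAction using (sum)
open import Data.Nat.Divisibility using (_∣_; divides)
open import Data.Product using (_×_; _,_; ∃; proj₁; proj₂; uncurry)
open import Data.Sum using (_⊎_; inj₁; inj₂; [_,_]′)
open import Data.Empty using (⊥-elim)
open import Data.Unit using (tt)
open import Function using (_∘_; Equivalence)
open import Relation.Nullary using (¬_; yes; no)
open import Relation.Nullary.Decidable using (toWitness; fromWitness; fromWitnessFalse)
open import Relation.Binary using (tri<; tri≈; tri>)
open import Relation.Binary.PropositionalEquality
open import Relation.Binary.Construct.Closure.ReflexiveTransitive using (Star; ε; _◅_; _◅◅_)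

private
  variable
    A B : Set
    s : ℕ

T⇒≡true : ∀ {b} → T b → b ≡ true
T⇒≡true = Equivalence.to T-≡

≡true⇒T : ∀ {b} → b ≡ true → T b
≡true⇒T = Equivalence.from T-≡

T-∧ˡ : ∀ {a b} → T (a ∧ b) → T a
T-∧ˡ {true} _ = tt

T-∧ʳ : ∀ {a b} → T (a ∧ b) → T b
T-∧ʳ {true} t = t

T-∧⁺ : ∀ {a b} → T a → T b → T (a ∧ b)
T-∧⁺ {true} _ t = t

T-not⇒≡false : ∀ {b} → T (not b) → b ≡ false
T-not⇒≡false = Equivalence.to T-not-≡

≡ᵇ-refl : ∀ n → (n ≡ᵇ n) ≡ true
≡ᵇ-refl n = T⇒≡true (≡⇒≡ᵇ n n refl)

≢⇒≡ᵇ≡false : ∀ {a b} → a ≢ b → (a ≡ᵇ b) ≡ false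
≢⇒≡ᵇ≡false {a} {b} a≢b with a ≡ᵇ b in eq
... | false = refl
... | true  = ⊥-elim (a≢b (≡ᵇ⇒≡ a b (≡true⇒T eq)))

≤⇒≤ᵇ≡true : ∀ {a b} → a ≤ b → (a ≤ᵇ b) ≡ true
≤⇒≤ᵇ≡true = T⇒≡true ∘ ≤⇒≤ᵇ

>⇒≤ᵇ≡false : ∀ {a b} → b < a → (a ≤ᵇ b) ≡ false
>⇒≤ᵇ≡false {a} {b} b<a with a ≤ᵇ b in eq
... | false = refl
... | true  = ⊥-elim (<⇒≱ b<a (≤ᵇ⇒≤ a b (≡true⇒T eq)))

-- Counting

count-cong : {f g : Fin s → Bool} → (∀ i → f i ≡ g i) → count f ≡ count g
count-cong {zero}  e = refl
count-cong {suc s} e rewrite e fzero = cong (_ +_) (count-cong (e ∘ fsuc))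

count-+ : ∀ a b (f : Fin (a + b) → Bool) → count f ≡ count (f ∘ (_↑ˡ b)) + count (f ∘ (a ↑ʳ_))
count-+ zero    b f = refl
count-+ (suc a) b f with f fzero
... | true  = cong suc (count-+ a b (f ∘ fsuc))
... | false = count-+ a b (f ∘ fsuc)

count≡0 : {f : Fin s → Bool} → (∀ i → f i ≡ false) → count f ≡ 0
count≡0 {zero}  e = refl
count≡0 {suc s} e rewrite e fzero = count≡0 (e ∘ fsuc)

count-pos : (f : Fin s → Bool) {i : Fin s} → T (f i) → 1 ≤ count f
count-pos f {fzero} t with f fzero
... | true = s≤s z≤n
count-pos f {fsuc i} t with f fzero
... | true  = s≤s z≤n
... | false = count-pos (f ∘ fsuc) t

count≤1 : (f : Fin s → Bool) → (∀ a b → T (f a) → T (f b) → a ≡ b) → count f ≤ 1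
count≤1 {zero}  f unique = z≤n
count≤1 {suc s} f unique with f fzero in eq
... | true  = s≤s (≤-reflexive (count≡0 others))
  where
  others : ∀ i → f (fsuc i) ≡ false
  others i with f (fsuc i) in eq′
  ... | false = refl
  ... | true with unique fzero (fsuc i) (≡true⇒T eq) (≡true⇒T eq′)
  ... | ()
... | false = count≤1 (f ∘ fsuc) (λ a b ta tb → Fin.suc-injective (unique (fsuc a) (fsuc b) ta tb))

count-pos⇒∃ : (f : Fin s → Bool) → 1 ≤ count f → ∃ λ i → T (f i)
count-pos⇒∃ {suc s} f pos with f fzero in eq
... | true  = fzero , ≡true⇒T eq
... | false with count-pos⇒∃ (f ∘ fsuc) pos
... | i , t = fsuc i , t

search : (f : Fin s → Bool) → (∃ λ i → T (f i)) ⊎ (∀ i → f i ≡ false)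
search {zero}  f = inj₂ λ ()
search {suc s} f with f fzero in eq
... | true  = inj₁ (fzero , ≡true⇒T eq)
... | false with search (f ∘ fsuc)
... | inj₁ (i , t) = inj₁ (fsuc i , t)
... | inj₂ none    = inj₂ λ { fzero → eq ; (fsuc i) → none i }

someFin-intro : (f : Fin s → Bool) (i : Fin s) → T (f i) → someFin f ≡ true
someFin-intro f i t with count f | count-pos f t
... | suc _ | _ = refl

someFin⇒∃ : (f : Fin s → Bool) → someFin f ≡ true → ∃ λ i → T (f i)
someFin⇒∃ f e with count f in eq
... | suc _ = count-pos⇒∃ f (subst (1 ≤_) (sym eq) (s≤s z≤n))

someFin-false : (f : Fin s → Bool) → (∀ i → f i ≡ false) → someFin f ≡ false
someFin-false f none rewrite count≡0 none = refl

#filter : (A → Bool) → List A → ℕ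
#filter p xs = length (filterᵇ p xs)

not-null≡1≤ᵇlength : (xs : List A) → not (null xs) ≡ (1 ≤ᵇ length xs)
not-null≡1≤ᵇlength []      = refl
not-null≡1≤ᵇlength (_ ∷ _) = refl

#filter-cong : {p q : A → Bool} → (∀ x → p x ≡ q x) → ∀ xs → #filter p xs ≡ #filter q xs
#filter-cong e xs = cong length (filter-≐ (T? ∘ _) (T? ∘ _)
  ((λ {x} → subst T (e x)) , (λ {x} → subst T (sym (e x)))) xs)

#filter≡0 : {p : A → Bool} {xs : List A} → All (λ x → p x ≡ false) xs → #filter p xs ≡ 0
#filter≡0 none = cong length (filter-none (T? ∘ _) (All.map (λ e t → subst T e t) none))

#filter-pos : (p : A → Bool) {x : A} {xs : List A} → x ∈ xs → T (p x) → 1 ≤ #filter p xs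
#filter-pos p x∈xs t = filter-some (T? ∘ p) (Any.map (λ { refl → t }) x∈xs)

#filter-≥2 : (p : A → Bool) {x y : A} (xs : List A) → x ∈ xs → y ∈ xs → x ≢ y → T (p x) → T (p y) →
             2 ≤ #filter p xs
#filter-≥2 p (z ∷ xs) (here refl) (here refl) x≢y _ _ = ⊥-elim (x≢y refl)
#filter-≥2 p (z ∷ xs) (here refl) (there y∈xs) _ _ ty with p z
... | true = s≤s (#filter-pos p y∈xs ty)
#filter-≥2 p (z ∷ xs) (there x∈xs) (here refl) _ tx _ with p z
... | true = s≤s (#filter-pos p x∈xs tx)
#filter-≥2 p (z ∷ xs) (there x∈xs) (there y∈xs) x≢y tx ty with p z
... | true  = s≤s (#filter-pos p x∈xs tx)
... | false = #filter-≥2 p xs x∈xs y∈xs x≢y tx ty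

#filter≤1 : (p : A → Bool) (w : A) (xs : List A) → Unique xs → (∀ x → T (p x) → x ≡ w) → #filter p xs ≤ 1
#filter≤1 p w []       _            _    = z≤n
#filter≤1 p w (x ∷ xs) (x∉xs ∷ uniq) only with p x in eq
... | true  = s≤s (≤-reflexive (#filter≡0 (rest x∉xs)))
  where
  rest : ∀ {ys} → All (x ≢_) ys → All (λ y → p y ≡ false) ys
  rest []                  = []
  rest {y ∷ ys} (x≢y ∷ ne) with p y in eq′
  ... | false = eq′ ∷ rest ne
  ... | true  = ⊥-elim (x≢y (trans (only x (≡true⇒T eq)) (sym (only y (≡true⇒T eq′)))))
... | false = #filter≤1 p w xs uniq only

#filter-map : (p : B → Bool) (f : A → B) (xs : List A) → #filter p (map f xs) ≡ #filter (p ∘ f) xs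
#filter-map p f []       = refl
#filter-map p f (x ∷ xs) with p (f x)
... | true  = cong suc (#filter-map p f xs)
... | false = #filter-map p f xs

#filter-cartesianProduct : (p : A × B → Bool) (xs : List A) (ys : List B) →
  #filter p (cartesianProduct xs ys) ≡ sum (map (λ x → #filter (λ y → p (x , y)) ys) xs)
#filter-cartesianProduct p []       ys = refl
#filter-cartesianProduct p (x ∷ xs) ys = begin
  #filter p (map (x ,_) ys ++ cartesianProduct xs ys)
    ≡⟨ cong length (filter-++ (T? ∘ p) (map (x ,_) ys) _) ⟩
  length (filterᵇ p (map (x ,_) ys) ++ filterᵇ p (cartesianProduct xs ys))
    ≡⟨ length-++ (filterᵇ p (map (x ,_) ys)) ⟩
  #filter p (map (x ,_) ys) + #filter p (cartesianProduct xs ys)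
    ≡⟨ cong₂ _+_ (#filter-map p (x ,_) ys) (#filter-cartesianProduct p xs ys) ⟩
  #filter (λ y → p (x , y)) ys + sum (map (λ x → #filter (λ y → p (x , y)) ys) xs) ∎
  where open ≡-Reasoning

#filter-tabulate : ∀ n (p : A → Bool) (f : Fin n → A) → #filter p (tabulate f) ≡ count (p ∘ f)
#filter-tabulate zero    p f = refl
#filter-tabulate (suc n) p f with p (f fzero)
... | true  = cong suc (#filter-tabulate n p (f ∘ fsuc))
... | false = #filter-tabulate n p (f ∘ fsuc)

firesᵇ : ℕ → ℕ → Bool
firesᵇ unprotected mobile = (1 ≤ᵇ unprotected) ∧ (unprotected ≤ᵇ mobile)

-- The deduction game on an arbitrary graph

module GameProperties (G : Graph) (k : ℕ) where
  open Graph G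
  open Game G k

  eqV-refl : ∀ v → eqV v v ≡ true
  eqV-refl v = T⇒≡true (fromWitness {a? = v ≟V v} refl)

  eqV⇒≡ : ∀ {u v} → T (eqV u v) → u ≡ v
  eqV⇒≡ = toWitness

  ≢⇒eqV≡false : ∀ {u v} → u ≢ v → eqV u v ≡ false
  ≢⇒eqV≡false {u} {v} u≢v = T-not⇒≡false (fromWitnessFalse {a? = u ≟V v} u≢v)

  unprotᵇ : Config s → V → V → Bool
  unprotᵇ c v u = adj v u ∧ not (prot c u)

  module _ (c : Config s) (v : V) where
    #unprot : ℕ
    #unprot = length (unprotNbrs c v)

    fires≡firesᵇ : fires c v ≡ firesᵇ #unprot (mobileAt c v)
    fires≡firesᵇ = cong (_∧ (#unprot ≤ᵇ mobileAt c v)) (not-null≡1≤ᵇlength (unprotNbrs c v))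

    fires⇒ : T (fires c v) → (1 ≤ #unprot) × (#unprot ≤ mobileAt c v)
    fires⇒ t with subst T fires≡firesᵇ t
    ... | t′ = ≤ᵇ⇒≤ 1 _ (T-∧ˡ t′) , ≤ᵇ⇒≤ _ _ (T-∧ʳ {1 ≤ᵇ #unprot} t′)

    fires≡true : 1 ≤ #unprot → #unprot ≤ mobileAt c v → fires c v ≡ true
    fires≡true 1≤u u≤a rewrite fires≡firesᵇ | ≤⇒≤ᵇ≡true 1≤u | ≤⇒≤ᵇ≡true u≤a = refl

    fires≡false : mobileAt c v < #unprot → fires c v ≡ false
    fires≡false a<u rewrite fires≡firesᵇ | >⇒≤ᵇ≡false a<u = ∧-zeroʳ _

  allProtected⇒fires≡false : (c : Config s) → (∀ v → prot c v ≡ true) → ∀ v → fires c v ≡ false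
  allProtected⇒fires≡false c allProt v =
    trans (fires≡firesᵇ c v) (cong (λ n → firesᵇ n (mobileAt c v)) #unprot≡0)
    where
    #unprot≡0 : #unprot c v ≡ 0
    #unprot≡0 = #filter≡0 (All.universal (λ u → trans (cong (λ b → adj v u ∧ not b) (allProt u)) (∧-zeroʳ (adj v u))) verts)

  -- A protected vertex is charged to the searcher that protected it, paired with that searcher's
  -- move count at the time; injectivity of the charge bounds the number of vertices by s (k + 1).
  record Charging (c : Config s) : Set where
    field
      charge           : ∀ v → prot c v ≡ true → Fin s × ℕ
      charge≤cnt       : ∀ v p → proj₂ (charge v p) ≤ cnt c (proj₁ (charge v p))
      charge-injective : ∀ u v pu pv → charge u pu ≡ charge v pv → u ≡ v
      cnt≤k            : ∀ i → cnt c i ≤ k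
      pos-protected    : ∀ i → prot c (pos c i) ≡ true

  charging-initial : (L : Fin s → V) → Charging (initial L)
  charging-initial {s} L = record
    { charge           = charge
    ; charge≤cnt       = λ _ _ → z≤n
    ; charge-injective = λ u v pu pv e →
        trans (sym (occupant-pos u pu)) (trans (cong (L ∘ proj₁) e) (occupant-pos v pv))
    ; cnt≤k            = λ _ → z≤n
    ; pos-protected    = λ i → someFin-intro _ i (≡true⇒T (eqV-refl (L i)))
    }
    where
    occupant : ∀ v → prot (initial L) v ≡ true → Fin s
    occupant v p = proj₁ (someFin⇒∃ (λ i → eqV (L i) v) p)
    occupant-pos : ∀ v p → L (occupant v p) ≡ v
    occupant-pos v p = eqV⇒≡ (proj₂ (someFin⇒∃ (λ i → eqV (L i) v) p))
    charge : ∀ v → prot (initial L) v ≡ true → Fin s × ℕ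
    charge v p = occupant v p , 0

  module _ {c c′ : Config s} (step : Step c c′) where
    open Step step

    cnt-moves : ∀ i → T (moves c i) → cnt c′ i ≡ suc (cnt c i)
    cnt-moves i mv = proj₂ (proj₂ (moveOK i mv))

    cnt-mono : ∀ i → cnt c i ≤ cnt c′ i
    cnt-mono i with T? (moves c i)
    ... | yes mv = ≤-trans (n≤1+n _) (≤-reflexive (sym (cnt-moves i mv)))
    ... | no ¬mv = ≤-reflexive (sym (proj₂ (stayOK i ¬mv)))

    data Protection (v : V) : Set where
      old : prot c v ≡ true → Protection v
      new : (i : Fin s) → pos c′ i ≡ v → T (moves c i) → Protection v

    protection : (∀ i → prot c (pos c i) ≡ true) → ∀ v → prot c′ v ≡ true → Protection v
    protection posProt v p′ with prot c v in p | search (λ i → eqV (pos c′ i) v)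
    ... | true  | _            = old p
    ... | false | inj₁ (i , t) = new i (eqV⇒≡ t) (moved (subst (λ u → prot c u ≡ false) (sym (eqV⇒≡ t)) p))
      where
      moved : prot c (pos c′ i) ≡ false → T (moves c i)
      moved unprot with T? (moves c i)
      ... | yes mv = mv
      ... | no ¬mv with trans (sym (posProt i)) (trans (cong (prot c) (sym (proj₁ (stayOK i ¬mv)))) unprot)
      ... | ()
    ... | false | inj₂ none with trans (sym p′) (trans (protOK v) (cong₂ _∨_ p (someFin-false _ none)))
    ... | ()

    charging-step : Charging c → Charging c′
    charging-step C = record
      { charge = charge′ ; charge≤cnt = charge′≤cnt ; charge-injective = charge′-injective
      ; cnt≤k = cnt′≤k ; pos-protected = pos′-protected }
      where
      module C = Charging C
      charge′ : ∀ v → prot c′ v ≡ true → Fin s × ℕ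
      charge′ v p with protection C.pos-protected v p
      ... | old po    = C.charge v po
      ... | new i _ _ = i , cnt c′ i
      charge′≤cnt : ∀ v p → proj₂ (charge′ v p) ≤ cnt c′ (proj₁ (charge′ v p))
      charge′≤cnt v p with protection C.pos-protected v p
      ... | old po    = ≤-trans (C.charge≤cnt v po) (cnt-mono _)
      ... | new i _ _ = ≤-refl
      old≢new : ∀ u pu i → T (moves c i) → C.charge u pu ≢ (i , cnt c′ i)
      old≢new u pu i mv e = <-irrefl refl (begin-strict
        cnt c i                 <⟨ n<1+n _ ⟩
        suc (cnt c i)           ≡⟨ cnt-moves i mv ⟨
        cnt c′ i                ≡⟨ cong proj₂ e ⟨
        proj₂ (C.charge u pu)   ≤⟨ C.charge≤cnt u pu ⟩
        cnt c (proj₁ (C.charge u pu)) ≡⟨ cong (cnt c ∘ proj₁) e ⟩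
        cnt c i                 ∎)
        where open ≤-Reasoning
      charge′-injective : ∀ u v pu pv → charge′ u pu ≡ charge′ v pv → u ≡ v
      charge′-injective u v pu pv e with protection C.pos-protected u pu | protection C.pos-protected v pv
      ... | old a      | old b      = C.charge-injective u v a b e
      ... | new i eu _ | new _ ev _ = trans (sym eu) (trans (cong (pos c′ ∘ proj₁) e) ev)
      ... | old a      | new i _ mv = ⊥-elim (old≢new u a i mv e)
      ... | new i _ mv | old b      = ⊥-elim (old≢new v b i mv (sym e))
      cnt′≤k : ∀ i → cnt c′ i ≤ k
      cnt′≤k i with T? (moves c i)
      ... | yes mv rewrite cnt-moves i mv = <ᵇ⇒< _ _ (T-∧ˡ mv)
      ... | no ¬mv rewrite proj₂ (stayOK i ¬mv) = C.cnt≤k i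
      pos′-protected : ∀ i → prot c′ (pos c′ i) ≡ true
      pos′-protected i rewrite protOK (pos c′ i)
                             | someFin-intro (λ j → eqV (pos c′ j) (pos c′ i)) i (≡true⇒T (eqV-refl _)) = ∨-zeroʳ _

  charging-star : {c c′ : Config s} → Star Step c c′ → Charging c → Charging c′
  charging-star ε          C = C
  charging-star (st ◅ run) C = charging-star run (charging-step st C)

  successful⇒injection-bound : (L : Fin s → V) → Successful L →
                                ∀ n (e : Fin n → V) → (∀ x y → e x ≡ e y → x ≡ y) → n ≤ s * suc k
  successful⇒injection-bound {s} L (c , run , allProt) n e e-injective = injective⇒≤ f-injective
    where
    module C = Charging (charging-star run (charging-initial L))
    charge : Fin n → Fin s × ℕ
    charge x = C.charge (e x) (allProt (e x))
    charge<k+1 : ∀ x → proj₂ (charge x) < suc k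
    charge<k+1 x = s≤s (≤-trans (C.charge≤cnt _ _) (C.cnt≤k _))
    f : Fin n → Fin (s * suc k)
    f x = combine (proj₁ (charge x)) (fromℕ< (charge<k+1 x))
    f-injective : ∀ {x y} → f x ≡ f y → x ≡ y
    f-injective {x} {y} eq with combine-injective _ _ _ _ eq
    ... | e₁ , e₂ = e-injective x y (C.charge-injective (e x) (e y) _ _ (cong₂ _,_ e₁
          (trans (sym (toℕ-fromℕ< (charge<k+1 x))) (trans (cong toℕ e₂) (toℕ-fromℕ< (charge<k+1 y))))))

  fires≡false-two-unprotected : (c : Config s) (v u w : V) → u ∈ verts → w ∈ verts → u ≢ w →
                                T (unprotᵇ c v u) → T (unprotᵇ c v w) → mobileAt c v ≤ 1 → fires c v ≡ false
  fires≡false-two-unprotected c v u w u∈ w∈ u≢w tu tw ≤1 =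
    fires≡false c v (<-≤-trans (s≤s ≤1) (#filter-≥2 (unprotᵇ c v) verts u∈ w∈ u≢w tu tw))

  fires≡true-single-unprotected : (c : Config s) (v u : V) → u ∈ verts → Unique verts →
                                  T (unprotᵇ c v u) → (∀ w → T (unprotᵇ c v w) → w ≡ u) → 1 ≤ mobileAt c v →
                                  fires c v ≡ true
  fires≡true-single-unprotected c v u u∈ unique tu only 1≤mob =
    fires≡true c v (#filter-pos (unprotᵇ c v) u∈ tu) (≤-trans (#filter≤1 (unprotᵇ c v) u verts unique only) 1≤mob)

  idle : (c : Config s) → (∀ v → prot c v ≡ true) → Step c c
  idle c allProt = record
    { moveOK = λ i mv → ⊥-elim (subst T (allProtected⇒fires≡false c allProt (pos c i)) (T-∧ʳ {mobile c i} mv))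
    ; stayOK = λ _ _ → refl , refl
    ; cover  = λ v _ fv _ _ → ⊥-elim (subst T (allProtected⇒fires≡false c allProt v) fv)
    ; protOK = λ u → trans (allProt u) (cong (_∨ _) (sym (allProt u)))
    }

  record _≈_ (c d : Config s) : Set where
    field
      pos≈  : ∀ i → pos c i ≡ pos d i
      cnt≈  : ∀ i → cnt c i ≡ cnt d i
      prot≈ : ∀ v → prot c v ≡ prot d v

  ≈-refl : {c : Config s} → c ≈ c
  ≈-refl = record { pos≈ = λ _ → refl ; cnt≈ = λ _ → refl ; prot≈ = λ _ → refl }

  module _ {c d : Config s} (c≈d : c ≈ d) where
    open _≈_ c≈d

    mobile≈ : ∀ i → mobile c i ≡ mobile d i
    mobile≈ i = cong (_<ᵇ k) (cnt≈ i)

    fires≈ : ∀ v → fires c v ≡ fires d v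
    fires≈ v = begin
      fires c v                                   ≡⟨ fires≡firesᵇ c v ⟩
      firesᵇ (#unprot c v) (mobileAt c v)         ≡⟨ cong₂ firesᵇ #unprot≈ mobileAt≈ ⟩
      firesᵇ (#unprot d v) (mobileAt d v)         ≡⟨ fires≡firesᵇ d v ⟨
      fires d v                                   ∎
      where
      open ≡-Reasoning
      #unprot≈ : #unprot c v ≡ #unprot d v
      #unprot≈ = #filter-cong (λ u → cong (λ b → adj v u ∧ not b) (prot≈ u)) verts
      mobileAt≈ : mobileAt c v ≡ mobileAt d v
      mobileAt≈ = count-cong λ i → cong₂ _∧_ (cong (λ p → eqV p v) (pos≈ i)) (mobile≈ i)

    moves≈ : ∀ i → moves c i ≡ moves d i
    moves≈ i = cong₂ _∧_ (mobile≈ i) (trans (cong (fires c) (pos≈ i)) (fires≈ (pos d i)))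

    Step-respˡ-≈ : {e : Config s} → Step d e → Step c e
    Step-respˡ-≈ {e} st = record
      { moveOK = λ i mv → let (a , p , n) = Step.moveOK st i (subst T (moves≈ i) mv) in
          trans (cong (λ x → adj x (pos e i)) (pos≈ i)) a , trans (prot≈ (pos e i)) p , trans n (cong suc (sym (cnt≈ i)))
      ; stayOK = λ i ¬mv → let (p , n) = Step.stayOK st i (¬mv ∘ subst T (sym (moves≈ i))) in
          trans p (sym (pos≈ i)) , trans n (sym (cnt≈ i))
      ; cover  = λ v u fv av pu → let (i , a , b , p) = Step.cover st v u (subst T (fires≈ v) fv) av (trans (sym (prot≈ u)) pu) in
          i , trans (pos≈ i) a , subst T (sym (mobile≈ i)) b , p
      ; protOK = λ u → trans (Step.protOK st u) (cong (_∨ _) (sym (prot≈ u)))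
      }

  Star-respˡ-≈ : {c d e : Config s} → c ≈ d → Star Step d e → ∃ λ e′ → Star Step c e′ × e′ ≈ e
  Star-respˡ-≈ c≈d ε          = _ , ε , c≈d
  Star-respˡ-≈ c≈d (st ◅ run) = _ , Step-respˡ-≈ c≈d st ◅ run , ≈-refl

-- Grids

Consecutive : ℕ → ℕ → Set
Consecutive a b = suc a ≡ b ⊎ suc b ≡ a

adj1⇒Consecutive : ∀ a b → T (adj1 a b) → Consecutive a b
adj1⇒Consecutive a b t with Equivalence.to (T-∨ {suc a ≡ᵇ b}) t
... | inj₁ e = inj₁ (≡ᵇ⇒≡ _ _ e)
... | inj₂ e = inj₂ (≡ᵇ⇒≡ _ _ e)

Consecutive⇒adj1 : ∀ a b → Consecutive a b → adj1 a b ≡ true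
Consecutive⇒adj1 a .(suc a) (inj₁ refl) rewrite ≡ᵇ-refl a = refl
Consecutive⇒adj1 .(suc b) b (inj₂ refl) rewrite ≡ᵇ-refl b = ∨-zeroʳ _

module _ {m n : ℕ} where
  open Graph (grid m n)

  grid-adj⇒ : ∀ i x i′ y → adj (i , x) (i′ , y) ≡ true →
              (toℕ x ≡ toℕ y × Consecutive (toℕ i) (toℕ i′)) ⊎ (i ≡ i′ × Consecutive (toℕ x) (toℕ y))
  grid-adj⇒ i x i′ y e with Equivalence.to (T-∨ {adj1 (toℕ i) (toℕ i′) ∧ (toℕ x ≡ᵇ toℕ y)}) (≡true⇒T e)
  ... | inj₁ t = inj₁ (≡ᵇ⇒≡ _ _ (T-∧ʳ t) , adj1⇒Consecutive _ _ (T-∧ˡ t))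
  ... | inj₂ t = inj₂ (toℕ-injective (≡ᵇ⇒≡ _ _ (T-∧ˡ t)) , adj1⇒Consecutive _ _ (T-∧ʳ t))

  grid-adj-horizontal : ∀ i x y → Consecutive (toℕ x) (toℕ y) → adj (i , x) (i , y) ≡ true
  grid-adj-horizontal i x y c rewrite ≡ᵇ-refl (toℕ i) | Consecutive⇒adj1 (toℕ x) (toℕ y) c = ∨-zeroʳ _

  #filter-grid : (p : Fin m × Fin n → Bool) → #filter p verts ≡ sum (map (λ i → count (λ j → p (i , j))) (allFin m))
  #filter-grid p = trans (#filter-cartesianProduct p (allFin m) (allFin n))
                         (cong sum (map-cong (λ i → #filter-tabulate n (λ j → p (i , j)) (λ j → j)) (allFin m)))

  grid-verts-complete : ∀ v → v ∈ verts
  grid-verts-complete (i , j) = ∈-cartesianProduct⁺ (∈-allFin i) (∈-allFin j)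

  grid-verts-unique : Unique verts
  grid-verts-unique = cartesianProduct⁺ (allFin⁺ m) (allFin⁺ n)

grid-adj-cong : ∀ {m n n′} (i i′ : Fin m) {x y : Fin n} {x′ y′ : Fin n′} → toℕ x ≡ toℕ x′ → toℕ y ≡ toℕ y′ →
                Graph.adj (grid m n) (i , x) (i′ , y) ≡ Graph.adj (grid m n′) (i , x′) (i′ , y′)
grid-adj-cong i i′ ex ey rewrite ex | ey = refl

successful⇒grid-bound : ∀ k m n {s} (L : Fin s → Fin m × Fin n) → Game.Successful (grid m n) k L → m * n ≤ s * suc k
successful⇒grid-bound k m n L success =
  GameProperties.successful⇒injection-bound (grid m n) k L success (m * n) (remQuot {m} n) remQuot-injective
  where
  remQuot-injective : ∀ x y → remQuot {m} n x ≡ remQuot n y → x ≡ y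
  remQuot-injective x y e =
    trans (sym (combine-remQuot {m} n x)) (trans (cong (uncurry combine) e) (combine-remQuot {m} n y))

-- Sweeping the extra columns

-- The sweepers of one row move in turn, one block after the other: when the row has made t moves
-- in total, the sweeper of block j is active iff j k ≤ t < j k + k and has made sweeperMoves t j moves.
module Schedule (k : ℕ) where

  sweeperMoves : ℕ → ℕ → ℕ
  sweeperMoves t j = k ⊓ (t ∸ j * k)

  -- offset 0 of every block holds its sweeper from the start
  sweptᵇ : ℕ → ℕ → ℕ → Bool
  sweptᵇ t j r = (r ≡ᵇ 0) ∨ (j * k + r ≤ᵇ t)

  Active : ℕ → ℕ → Set
  Active t j = j * k ≤ t × t < j * k + k

  sweeperMoves-waiting : ∀ t j → t ≤ j * k → sweeperMoves t j ≡ 0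
  sweeperMoves-waiting t j t≤jk rewrite m≤n⇒m∸n≡0 t≤jk = ⊓-zeroʳ k

  sweptᵇ-initial : ∀ j r → sweptᵇ 0 j r ≡ (sweeperMoves 0 j ≡ᵇ r)
  sweptᵇ-initial j zero    rewrite sweeperMoves-waiting 0 j z≤n = refl
  sweptᵇ-initial j (suc r) rewrite sweeperMoves-waiting 0 j z≤n = >⇒≤ᵇ≡false (≤-trans (s≤s z≤n) (m≤n+m (suc r) (j * k)))

  sweeperMoves-active : ∀ t j → Active t j → sweeperMoves t j ≡ t ∸ j * k
  sweeperMoves-active t j (_ , t<jk+k) =
    m≥n⇒m⊓n≡n (≤-trans (∸-monoˡ-≤ (j * k) (<⇒≤ t<jk+k)) (≤-reflexive (m+n∸m≡n (j * k) k)))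

  sweeperMoves-done : ∀ t j → j * k + k ≤ t → sweeperMoves t j ≡ k
  sweeperMoves-done t j jk+k≤t = m≤n⇒m⊓n≡m (+-cancelʳ-≤ _ _ _ (begin
    k + j * k           ≡⟨ +-comm k _ ⟩
    j * k + k           ≤⟨ jk+k≤t ⟩
    t                   ≡⟨ m∸n+n≡m (≤-trans (m≤m+n _ k) jk+k≤t) ⟨
    t ∸ j * k + j * k   ∎))
    where open ≤-Reasoning

  sweeperMoves<k⇒ : ∀ t j → sweeperMoves t j < k → t < j * k + k
  sweeperMoves<k⇒ t j <k with k ≤? t ∸ j * k
  ... | yes k≤ = ⊥-elim (<-irrefl (m≤n⇒m⊓n≡m k≤) <k)
  ... | no  k≰ = begin-strict
    t                   ≤⟨ m≤n+m∸n t (j * k) ⟩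
    j * k + (t ∸ j * k) <⟨ +-monoʳ-< (j * k) (≰⇒> k≰) ⟩
    j * k + k           ∎
    where open ≤-Reasoning

  sweeperMoves≡suc⇒ : ∀ t j r → sweeperMoves t j ≡ suc r → j * k + suc r ≤ t
  sweeperMoves≡suc⇒ t j r e with j * k ≤? t
  ... | yes jk≤t = begin
    j * k + suc r       ≤⟨ +-monoʳ-≤ (j * k) (≤-trans (≤-reflexive (sym e)) (m⊓n≤n k _)) ⟩
    j * k + (t ∸ j * k) ≡⟨ m+[n∸m]≡n jk≤t ⟩
    t                   ∎
    where open ≤-Reasoning
  ... | no jk≰t with trans (sym (sweeperMoves-waiting t j (<⇒≤ (≰⇒> jk≰t)))) e
  ... | ()

  sweeperMoves-suc-active : ∀ t j → Active t j → sweeperMoves (suc t) j ≡ suc (sweeperMoves t j)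
  sweeperMoves-suc-active t j act@(jk≤t , t<jk+k) rewrite sweeperMoves-active t j act | +-∸-assoc 1 jk≤t =
    m≥n⇒m⊓n≡n (+-cancelˡ-< (j * k) _ k (subst (_< j * k + k) (sym (m+[n∸m]≡n jk≤t)) t<jk+k))

  sweeperMoves-suc-inactive : ∀ t j j′ → j ≢ j′ → Active t j′ → sweeperMoves (suc t) j ≡ sweeperMoves t j
  sweeperMoves-suc-inactive t j j′ j≢j′ (j′k≤t , t<j′k+k) with <-cmp j j′
  ... | tri≈ _ j≡j′ _ = ⊥-elim (j≢j′ j≡j′)
  ... | tri< j<j′ _ _ = trans (sweeperMoves-done (suc t) j (≤-trans done (n≤1+n t))) (sym (sweeperMoves-done t j done))
    where
    done : j * k + k ≤ t
    done = ≤-trans (≤-reflexive (+-comm _ k)) (≤-trans (*-monoˡ-≤ k j<j′) j′k≤t)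
  ... | tri> _ _ j′<j = trans (sweeperMoves-waiting (suc t) j waiting) (sym (sweeperMoves-waiting t j (≤-trans (n≤1+n t) waiting)))
    where
    waiting : suc t ≤ j * k
    waiting = ≤-trans t<j′k+k (≤-trans (≤-reflexive (+-comm _ k)) (*-monoˡ-≤ k j′<j))

  sweptᵇ-moves : ∀ t j r → sweeperMoves t j ≡ r → sweptᵇ t j r ≡ true
  sweptᵇ-moves t j zero    _ = refl
  sweptᵇ-moves t j (suc r) e rewrite ≤⇒≤ᵇ≡true (sweeperMoves≡suc⇒ t j r e) = refl

  sweptᵇ-unchanged : ∀ t t′ j r → r ≤ k → t′ ≡ t ⊎ t′ ≡ suc t → sweeperMoves t′ j ≢ r →
                     sweptᵇ t′ j r ≡ sweptᵇ t j r
  sweptᵇ-unchanged t .t       j r       _   (inj₁ refl) _  = refl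
  sweptᵇ-unchanged t .(suc t) j zero    _   (inj₂ refl) _  = refl
  sweptᵇ-unchanged t .(suc t) j (suc r) r<k (inj₂ refl) ne with j * k + suc r ≤? t
  ... | yes le  rewrite ≤⇒≤ᵇ≡true le | ≤⇒≤ᵇ≡true (≤-trans le (n≤1+n t)) = refl
  ... | no  nle rewrite >⇒≤ᵇ≡false (≰⇒> nle) = >⇒≤ᵇ≡false (≤∧≢⇒< (≰⇒> nle) (ne ∘ moved))
    where
    moved : suc t ≡ j * k + suc r → sweeperMoves (suc t) j ≡ suc r
    moved e = begin
      k ⊓ (suc t ∸ j * k)         ≡⟨ cong (λ x → k ⊓ (x ∸ j * k)) e ⟩
      k ⊓ (j * k + suc r ∸ j * k) ≡⟨ cong (k ⊓_) (m+n∸m≡n (j * k) (suc r)) ⟩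
      k ⊓ suc r                   ≡⟨ m≥n⇒m⊓n≡n r<k ⟩
      suc r                       ∎
      where open ≡-Reasoning

  sweptᵇ-step : ∀ t t′ j r → r ≤ k → t′ ≡ t ⊎ t′ ≡ suc t →
                sweptᵇ t′ j r ≡ (sweptᵇ t j r ∨ (sweeperMoves t′ j ≡ᵇ r))
  sweptᵇ-step t t′ j r r≤k t′≡ with sweeperMoves t′ j ≟ r
  ... | yes e rewrite sweptᵇ-moves t′ j r e | e | ≡ᵇ-refl r = sym (∨-zeroʳ _)
  ... | no ne rewrite ≢⇒≡ᵇ≡false ne | ∨-identityʳ (sweptᵇ t j r) = sweptᵇ-unchanged t t′ j r r≤k t′≡ ne

  activeBlock : ∀ q t → t < q * k → ∃ λ (j : Fin q) → Active t (toℕ j)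
  activeBlock (suc q) t t<q*k with t <? k
  ... | yes t<k = fzero , z≤n , t<k
  ... | no  t≮k = next (activeBlock q (t ∸ k) (+-cancelˡ-< k _ _ (subst (_< k + q * k) (sym k+[t∸k]≡t) t<q*k)))
    where
    k+[t∸k]≡t : k + (t ∸ k) ≡ t
    k+[t∸k]≡t = m+[n∸m]≡n (≮⇒≥ t≮k)
    next : ∃ (λ (j : Fin q) → Active (t ∸ k) (toℕ j)) → ∃ λ (j : Fin (suc q)) → Active t (toℕ j)
    next (j , jk≤t∸k , t∸k<jk+k) = fsuc j ,
      subst (k + toℕ j * k ≤_) k+[t∸k]≡t (+-monoʳ-≤ k jk≤t∸k) ,
      subst (_< k + toℕ j * k + k) k+[t∸k]≡t (subst (k + (t ∸ k) <_) (sym (+-assoc k _ k)) (+-monoʳ-< k t∸k<jk+k))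

  left-neighbour-swept-no-later : ∀ j j′ r′ a → r′ ≤ k → a < suc k → suc (suc k * j′ + r′) ≡ suc k * j + a →
                                  j′ * k + r′ ≤ j * k + a
  left-neighbour-swept-no-later j j′ r′ a r′≤k a<K e with <-cmp j′ j
  ... | tri< j′<j _ _ = begin
    j′ * k + r′   ≤⟨ +-monoʳ-≤ (j′ * k) r′≤k ⟩
    j′ * k + k    ≡⟨ +-comm _ k ⟩
    suc j′ * k    ≤⟨ *-monoˡ-≤ k j′<j ⟩
    j * k         ≤⟨ m≤m+n _ a ⟩
    j * k + a     ∎
    where open ≤-Reasoning
  ... | tri≈ _ refl _ = +-monoʳ-≤ (j * k) (<⇒≤ (+-cancelˡ-< (suc k * j) r′ a (≤-reflexive e)))
  ... | tri> _ _ j<j′ = ⊥-elim (<-irrefl refl (begin-strict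
    suc k * j′               ≤⟨ m≤m+n _ r′ ⟩
    suc k * j′ + r′          <⟨ n<1+n _ ⟩
    suc (suc k * j′ + r′)    ≡⟨ e ⟩
    suc k * j + a            <⟨ +-monoʳ-< (suc k * j) a<K ⟩
    suc k * j + suc k        ≡⟨ +-comm _ (suc k) ⟩
    suc k + suc k * j        ≡⟨ *-suc (suc k) j ⟨
    suc k * suc j            ≤⟨ *-monoʳ-≤ (suc k) j<j′ ⟩
    suc k * j′               ∎))
    where open ≤-Reasoning

module _ {X : Set} (a b : ℕ) (f : Fin a → X) (g : Fin b → X) where
  [,]′∘splitAt-↑ˡ : ∀ x → [ f , g ]′ (splitAt a (x ↑ˡ b)) ≡ f x
  [,]′∘splitAt-↑ˡ x rewrite splitAt-↑ˡ a x b = refl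

  [,]′∘splitAt-↑ʳ : ∀ y → [ f , g ]′ (splitAt a (a ↑ʳ y)) ≡ g y
  [,]′∘splitAt-↑ʳ y rewrite splitAt-↑ʳ a b y = refl

data SplitView (a b : ℕ) : Fin (a + b) → Set where
  is-left  : (x : Fin a) → SplitView a b (x ↑ˡ b)
  is-right : (y : Fin b) → SplitView a b (a ↑ʳ y)

splitView : ∀ a b (x : Fin (a + b)) → SplitView a b x
splitView a b x with splitAt a x in eq
... | inj₁ y = subst (SplitView a b) (splitAt⁻¹-↑ˡ eq) (is-left y)
... | inj₂ y = subst (SplitView a b) (splitAt⁻¹-↑ʳ eq) (is-right y)

data CombineView (a b : ℕ) : Fin (a * b) → Set where
  is-combined : (i : Fin a) (j : Fin b) → CombineView a b (combine i j)

combineView : ∀ a b (x : Fin (a * b)) → CombineView a b x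
combineView a b x = subst (CombineView a b) (combine-remQuot {a} b x) (is-combined _ _)

-- The small grid P_m □ P_{n₁}, with d₁ searchers, followed by q blocks of k + 1 columns; every row of
-- every block has one sweeper, starting in the first column of the block.
module Sweep (k : ℕ) (k≥1 : 1 ≤ k) (m n₁ q d₁ : ℕ) where
  open Schedule k

  K n₂ n #searchers : ℕ
  K = suc k
  n₂ = q * K
  n = n₁ + n₂
  #searchers = d₁ + m * q

  Small Big : Graph
  Small = grid m n₁
  Big   = grid m n

  module S  = Game Small k
  module B  = Game Big k
  module SP = GameProperties Small k
  module BP = GameProperties Big k

  embed : Fin m × Fin n₁ → Fin m × Fin n
  embed (i , c) = i , c ↑ˡ n₂

  blockCol : Fin q → Fin K → Fin n
  blockCol j r = n₁ ↑ʳ combine j r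

  small : Fin d₁ → Fin #searchers
  small a = a ↑ˡ (m * q)

  sweeper : Fin m → Fin q → Fin #searchers
  sweeper i j = d₁ ↑ʳ combine i j

  sweeperOffset : ℕ → Fin q → Fin K
  sweeperOffset t j = fromℕ< (s≤s (m⊓n≤m k (t ∸ toℕ j * k)))

  sweeperVertex : (Fin m → ℕ) → Fin m → Fin q → Fin m × Fin n
  sweeperVertex t i j = i , blockCol j (sweeperOffset (t i) j)

  -- The configuration of the big game in which the small game is in configuration c₁
  -- and row i of the sweepers has made t i moves.
  module _ (c₁ : S.Config d₁) (t : Fin m → ℕ) where
    abstract
      posᴱ : Fin #searchers → Fin m × Fin n
      posᴱ x = [ embed ∘ S.pos c₁ , uncurry (sweeperVertex t) ∘ remQuot {m} q ]′ (splitAt d₁ {m * q} x)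

      cntᴱ : Fin #searchers → ℕ
      cntᴱ x = [ S.cnt c₁ , uncurry (λ i j → sweeperMoves (t i) (toℕ j)) ∘ remQuot {m} q ]′ (splitAt d₁ {m * q} x)

      protᴱ : Fin m × Fin n → Bool
      protᴱ (i , col) = [ (λ c → S.prot c₁ (i , c)) , uncurry (λ j r → sweptᵇ (t i) (toℕ j) (toℕ r)) ∘ remQuot {q} K ]′ (splitAt n₁ {n₂} col)

      pos-small : ∀ a → posᴱ (small a) ≡ embed (S.pos c₁ a)
      pos-small = [,]′∘splitAt-↑ˡ d₁ (m * q) _ _

      pos-sweeper : ∀ i j → posᴱ (sweeper i j) ≡ sweeperVertex t i j
      pos-sweeper i j = trans ([,]′∘splitAt-↑ʳ d₁ (m * q) _ _ (combine i j))
                              (cong (uncurry (sweeperVertex t)) (remQuot-combine i j))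

      cnt-small : ∀ a → cntᴱ (small a) ≡ S.cnt c₁ a
      cnt-small = [,]′∘splitAt-↑ˡ d₁ (m * q) _ _

      cnt-sweeper : ∀ i j → cntᴱ (sweeper i j) ≡ sweeperMoves (t i) (toℕ j)
      cnt-sweeper i j = trans ([,]′∘splitAt-↑ʳ d₁ (m * q) _ _ (combine i j))
                              (cong (uncurry (λ i j → sweeperMoves (t i) (toℕ j))) (remQuot-combine i j))

      prot-embed : ∀ v → protᴱ (embed v) ≡ S.prot c₁ v
      prot-embed (i , c) = [,]′∘splitAt-↑ˡ n₁ n₂ _ _ c

      prot-block : ∀ i j r → protᴱ (i , blockCol j r) ≡ sweptᵇ (t i) (toℕ j) (toℕ r)
      prot-block i j r = trans ([,]′∘splitAt-↑ʳ n₁ n₂ _ _ (combine j r))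
                               (cong (uncurry (λ j r → sweptᵇ (t i) (toℕ j) (toℕ r))) (remQuot-combine j r))

    extend : B.Config #searchers
    extend = B.config posᴱ cntᴱ protᴱ

  toℕ-blockCol : ∀ j r → toℕ (blockCol j r) ≡ n₁ + (K * toℕ j + toℕ r)
  toℕ-blockCol j r = trans (toℕ-↑ʳ n₁ (combine j r)) (cong (n₁ +_) (toℕ-combine j r))

  toℕ-sweeperOffset : ∀ t j → toℕ (sweeperOffset t j) ≡ sweeperMoves t (toℕ j)
  toℕ-sweeperOffset t j = toℕ-fromℕ< _

  blockCol-injective : ∀ {j r j′ r′} → blockCol j r ≡ blockCol j′ r′ → j ≡ j′ × r ≡ r′
  blockCol-injective e = combine-injective _ _ _ _ (↑ʳ-injective n₁ _ _ e)

  embed-injective : ∀ {u v} → embed u ≡ embed v → u ≡ v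
  embed-injective {_ , c} {_ , c′} e = cong₂ _,_ (cong proj₁ e) (↑ˡ-injective n₂ c c′ (cong proj₂ e))

  left<block : ∀ (c : Fin n₁) j r → toℕ (c ↑ˡ n₂) < toℕ (blockCol j r)
  left<block c j r = begin-strict
    toℕ (c ↑ˡ n₂)            ≡⟨ toℕ-↑ˡ c n₂ ⟩
    toℕ c                    <⟨ toℕ<n c ⟩
    n₁                       ≤⟨ m≤m+n n₁ _ ⟩
    n₁ + toℕ (combine j r)   ≡⟨ toℕ-↑ʳ n₁ (combine j r) ⟨
    toℕ (blockCol j r)       ∎
    where open ≤-Reasoning

  embed≢block : ∀ v i j r → embed v ≢ (i , blockCol j r)
  embed≢block (_ , c) i j r e = <-irrefl (cong (toℕ ∘ proj₂) e) (left<block c j r)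

  eqV-embed : ∀ u v → B.eqV (embed u) (embed v) ≡ S.eqV u v
  eqV-embed u v with Graph._≟V_ Small u v
  ... | yes refl = BP.eqV-refl (embed u)
  ... | no  u≢v  = BP.≢⇒eqV≡false (u≢v ∘ embed-injective)

  adj-embed : ∀ u v → Graph.adj Big (embed u) (embed v) ≡ Graph.adj Small u v
  adj-embed (i , c) (i′ , c′) = grid-adj-cong i i′ (toℕ-↑ˡ c n₂) (toℕ-↑ˡ c′ n₂)

  adj-embed-block⇒offset0 : ∀ v i j r → Graph.adj Big (embed v) (i , blockCol j r) ≡ true → toℕ r ≡ 0
  adj-embed-block⇒offset0 (i₀ , c) i j r e with grid-adj⇒ i₀ (c ↑ˡ n₂) i (blockCol j r) e
  ... | inj₁ (same , _)        = ⊥-elim (<-irrefl same (left<block c j r))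
  ... | inj₂ (_ , inj₂ right)  = ⊥-elim (<-asym (left<block c j r) (≤-reflexive right))
  ... | inj₂ (_ , inj₁ left)   = m+n≡0⇒n≡0 (K * toℕ j) (n≤0⇒n≡0 (+-cancelˡ-≤ n₁ _ _ (begin
    n₁ + (K * toℕ j + toℕ r)  ≡⟨ toℕ-blockCol j r ⟨
    toℕ (blockCol j r)        ≡⟨ left ⟨
    suc (toℕ (c ↑ˡ n₂))       ≡⟨ cong suc (toℕ-↑ˡ c n₂) ⟩
    suc (toℕ c)               ≤⟨ toℕ<n c ⟩
    n₁                        ≡⟨ +-identityʳ n₁ ⟨
    n₁ + 0                    ∎)))
    where open ≤-Reasoning

  blockCol-consecutive : ∀ j r j′ r′ → suc (K * toℕ j + toℕ r) ≡ K * toℕ j′ + toℕ r′ →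
                         suc (toℕ (blockCol j r)) ≡ toℕ (blockCol j′ r′)
  blockCol-consecutive j r j′ r′ e = begin
    suc (toℕ (blockCol j r))     ≡⟨ cong suc (toℕ-blockCol j r) ⟩
    suc (n₁ + (K * toℕ j + toℕ r)) ≡⟨ +-suc n₁ _ ⟨
    n₁ + suc (K * toℕ j + toℕ r) ≡⟨ cong (n₁ +_) e ⟩
    n₁ + (K * toℕ j′ + toℕ r′)   ≡⟨ toℕ-blockCol j′ r′ ⟨
    toℕ (blockCol j′ r′)         ∎
    where open ≡-Reasoning

  blockCol-consecutive⁻¹ : ∀ j r j′ r′ → suc (toℕ (blockCol j r)) ≡ toℕ (blockCol j′ r′) →
                           suc (K * toℕ j + toℕ r) ≡ K * toℕ j′ + toℕ r′
  blockCol-consecutive⁻¹ j r j′ r′ e = +-cancelˡ-≡ n₁ _ _ (begin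
    n₁ + suc (K * toℕ j + toℕ r)   ≡⟨ +-suc n₁ _ ⟩
    suc (n₁ + (K * toℕ j + toℕ r)) ≡⟨ cong suc (toℕ-blockCol j r) ⟨
    suc (toℕ (blockCol j r))       ≡⟨ e ⟩
    toℕ (blockCol j′ r′)           ≡⟨ toℕ-blockCol j′ r′ ⟩
    n₁ + (K * toℕ j′ + toℕ r′)     ∎)
    where open ≡-Reasoning

  previousBlock : ∀ (j : Fin q) {x} → x < toℕ j * k → ∃ λ (j₀ : Fin q) → suc (toℕ j₀) ≡ toℕ j
  previousBlock j x<jk with toℕ j | toℕ<n j
  ... | zero  | _   = ⊥-elim (n≮0 x<jk)
  ... | suc p | j<q = fromℕ< (≤-trans (n≤1+n _) j<q) , cong suc (toℕ-fromℕ< _)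

  data VertexView : Fin m × Fin n → Set where
    is-embedded : ∀ v → VertexView (embed v)
    is-block    : ∀ i j r → VertexView (i , blockCol j r)

  vertexView : ∀ v → VertexView v
  vertexView (i , col) with splitView n₁ n₂ col
  ... | is-left c  = is-embedded (i , c)
  ... | is-right y with combineView q K y
  ... | is-combined j r = is-block i j r

  data SearcherView : Fin #searchers → Set where
    is-small   : ∀ a → SearcherView (small a)
    is-sweeper : ∀ i j → SearcherView (sweeper i j)

  searcherView : ∀ x → SearcherView x
  searcherView x with splitView d₁ (m * q) x
  ... | is-left a  = is-small a
  ... | is-right y with combineView m q y
  ... | is-combined i j = is-sweeper i j

  module _ (c₁ : S.Config d₁) (t : Fin m → ℕ) where
    private
      C = extend c₁ t

    count-searchers : (f : Fin #searchers → Bool) (g : Fin d₁ → Bool) →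
                      (∀ a → f (small a) ≡ g a) → (∀ i j → f (sweeper i j) ≡ false) → count f ≡ count g
    count-searchers f g on-small on-sweeper = begin
      count f                                        ≡⟨ count-+ d₁ (m * q) f ⟩
      count (f ∘ small) + count (f ∘ (d₁ ↑ʳ_))       ≡⟨ cong₂ _+_ (count-cong on-small) (count≡0 on-sweepers) ⟩
      count g + 0                                    ≡⟨ +-identityʳ _ ⟩
      count g                                        ∎
      where
      open ≡-Reasoning
      on-sweepers : ∀ y → f (d₁ ↑ʳ y) ≡ false
      on-sweepers y with combineView m q y
      ... | is-combined i j = on-sweeper i j

    sweeper-not-embedded : ∀ i j v → B.eqV (posᴱ c₁ t (sweeper i j)) (embed v) ≡ false
    sweeper-not-embedded i j v rewrite pos-sweeper c₁ t i j =
      BP.≢⇒eqV≡false (λ e → embed≢block v i j _ (sym e))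

    eqV-small : ∀ a v → B.eqV (posᴱ c₁ t (small a)) (embed v) ≡ S.eqV (S.pos c₁ a) v
    eqV-small a v = trans (cong (λ u → B.eqV u (embed v)) (pos-small c₁ t a)) (eqV-embed _ v)

    mobileAt-embed : ∀ v → B.mobileAt C (embed v) ≡ S.mobileAt c₁ v
    mobileAt-embed v = count-searchers _ _
      (λ a → cong₂ _∧_ (eqV-small a v) (cong (_<ᵇ k) (cnt-small c₁ t a)))
      (λ i j → cong (_∧ _) (sweeper-not-embedded i j v))

    occupied-embed : ∀ v → someFin (λ x → B.eqV (posᴱ c₁ t x) (embed v)) ≡ someFin (λ a → S.eqV (S.pos c₁ a) v)
    occupied-embed v = cong (1 ≤ᵇ_) (count-searchers _ _ (λ a → eqV-small a v) (λ i j → sweeper-not-embedded i j v))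

    block-next-to-embed-protected : ∀ v i j r → Graph.adj Big (embed v) (i , blockCol j r) ≡ true →
                                    protᴱ c₁ t (i , blockCol j r) ≡ true
    block-next-to-embed-protected v i j r e rewrite prot-block c₁ t i j r | adj-embed-block⇒offset0 v i j r e = refl

    #unprot-embed : ∀ v → BP.#unprot C (embed v) ≡ SP.#unprot c₁ v
    #unprot-embed v = begin
      #filter unprotᴮ (Graph.verts Big)                                 ≡⟨ #filter-grid unprotᴮ ⟩
      sum (map (λ i → count (λ col → unprotᴮ (i , col))) (allFin m))    ≡⟨ cong sum (map-cong row (allFin m)) ⟩
      sum (map (λ i → count (λ c → unprotˢ (i , c))) (allFin m))        ≡⟨ #filter-grid unprotˢ ⟨
      #filter unprotˢ (Graph.verts Small)                               ∎
      where
      open ≡-Reasoning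
      unprotᴮ : Fin m × Fin n → Bool
      unprotᴮ u = Graph.adj Big (embed v) u ∧ not (protᴱ c₁ t u)
      unprotˢ : Fin m × Fin n₁ → Bool
      unprotˢ u = Graph.adj Small v u ∧ not (S.prot c₁ u)
      in-blocks : ∀ i y → unprotᴮ (i , n₁ ↑ʳ y) ≡ false
      in-blocks i y with combineView q K y
      ... | is-combined j r with Graph.adj Big (embed v) (i , blockCol j r) in e
      ...   | false = refl
      ...   | true rewrite block-next-to-embed-protected v i j r e = refl
      row : ∀ i → count (λ col → unprotᴮ (i , col)) ≡ count (λ c → unprotˢ (i , c))
      row i = begin
        count (λ col → unprotᴮ (i , col))
          ≡⟨ count-+ n₁ n₂ _ ⟩
        count (λ c → unprotᴮ (embed (i , c))) + count (λ y → unprotᴮ (i , n₁ ↑ʳ y))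
          ≡⟨ cong₂ _+_ (count-cong λ c → cong₂ (λ a p → a ∧ not p) (adj-embed v (i , c)) (prot-embed c₁ t (i , c)))
                       (count≡0 (in-blocks i)) ⟩
        count (λ c → unprotˢ (i , c)) + 0
          ≡⟨ +-identityʳ _ ⟩
        count (λ c → unprotˢ (i , c))
          ∎

    fires-embed : ∀ v → B.fires C (embed v) ≡ S.fires c₁ v
    fires-embed v = begin
      B.fires C (embed v)                                     ≡⟨ BP.fires≡firesᵇ C (embed v) ⟩
      firesᵇ (BP.#unprot C (embed v)) (B.mobileAt C (embed v)) ≡⟨ cong₂ firesᵇ (#unprot-embed v) (mobileAt-embed v) ⟩
      firesᵇ (SP.#unprot c₁ v) (S.mobileAt c₁ v)              ≡⟨ SP.fires≡firesᵇ c₁ v ⟨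
      S.fires c₁ v                                            ∎
      where open ≡-Reasoning

    moves-small : ∀ a → B.moves C (small a) ≡ S.moves c₁ a
    moves-small a rewrite cnt-small c₁ t a | pos-small c₁ t a | fires-embed (S.pos c₁ a) = refl

    sweeperVertex≡block⇒ : ∀ i j r → sweeperVertex t i j ≡ (i , blockCol j r) → sweeperMoves (t i) (toℕ j) ≡ toℕ r
    sweeperVertex≡block⇒ i j r e = trans (sym (toℕ-sweeperOffset (t i) j)) (cong toℕ (proj₂ (blockCol-injective (cong proj₂ e))))

    sweeperVertex≡block⇐ : ∀ i j r → sweeperMoves (t i) (toℕ j) ≡ toℕ r → sweeperVertex t i j ≡ (i , blockCol j r)
    sweeperVertex≡block⇐ i j r e = cong (λ z → i , blockCol j z) (toℕ-injective (trans (toℕ-sweeperOffset (t i) j) e))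

    at-block⇒sweeper : ∀ x i j r → posᴱ c₁ t x ≡ (i , blockCol j r) → x ≡ sweeper i j
    at-block⇒sweeper x i j r e with searcherView x
    ... | is-small a = ⊥-elim (embed≢block _ i j r (trans (sym (pos-small c₁ t a)) e))
    ... | is-sweeper i′ j′ with trans (sym (pos-sweeper c₁ t i′ j′)) e
    ...   | e′ with cong proj₁ e′ | proj₁ (blockCol-injective (cong proj₂ e′))
    ...     | refl | refl = refl

    mobileAt-block≤1 : ∀ i j r → B.mobileAt C (i , blockCol j r) ≤ 1
    mobileAt-block≤1 i j r = count≤1 _ λ x y tx ty →
      trans (at-block⇒sweeper x i j r (BP.eqV⇒≡ (T-∧ˡ tx))) (sym (at-block⇒sweeper y i j r (BP.eqV⇒≡ (T-∧ˡ ty))))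

    occupied-block : ∀ i j r → someFin (λ x → B.eqV (posᴱ c₁ t x) (i , blockCol j r)) ≡ (sweeperMoves (t i) (toℕ j) ≡ᵇ toℕ r)
    occupied-block i j r with sweeperMoves (t i) (toℕ j) ≟ toℕ r
    ... | yes e rewrite e | ≡ᵇ-refl (toℕ r) = someFin-intro _ (sweeper i j) (≡true⇒T (begin
      B.eqV (posᴱ c₁ t (sweeper i j)) (i , blockCol j r) ≡⟨ cong (λ u → B.eqV u (i , blockCol j r)) (pos-sweeper c₁ t i j) ⟩
      B.eqV (sweeperVertex t i j) (i , blockCol j r)     ≡⟨ cong (λ u → B.eqV u (i , blockCol j r)) (sweeperVertex≡block⇐ i j r e) ⟩
      B.eqV (i , blockCol j r) (i , blockCol j r)        ≡⟨ BP.eqV-refl _ ⟩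
      true                                               ∎))
      where open ≡-Reasoning
    ... | no ne rewrite ≢⇒≡ᵇ≡false ne = someFin-false _ not-there
      where
      not-there : ∀ x → B.eqV (posᴱ c₁ t x) (i , blockCol j r) ≡ false
      not-there x with B.eqV (posᴱ c₁ t x) (i , blockCol j r) in eq
      ... | false = refl
      ... | true with BP.eqV⇒≡ (≡true⇒T eq)
      ...   | e with at-block⇒sweeper x i j r e
      ...     | refl = ⊥-elim (ne (sweeperVertex≡block⇒ i j r (trans (sym (pos-sweeper c₁ t i j)) e)))

    waiting-sweeper-idle : ∀ i j → t i < toℕ j * k → B.fires C (sweeperVertex t i j) ≡ false
    waiting-sweeper-idle i j t<jk = BP.fires≡false-two-unprotected C home left right
      (grid-verts-complete left) (grid-verts-complete right) left≢right
      (unprotected left-adj left-unswept) (unprotected right-adj right-unswept) (mobileAt-block≤1 i j _)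
      where
      open ≡-Reasoning
      j₀  = proj₁ (previousBlock j t<jk)
      j≡1+j₀ : toℕ j ≡ suc (toℕ j₀)
      j≡1+j₀ = sym (proj₂ (previousBlock j t<jk))
      one : Fin K
      one = fromℕ< (s≤s k≥1)
      home left right : Fin m × Fin n
      home  = sweeperVertex t i j
      left  = i , blockCol j₀ (fromℕ k)
      right = i , blockCol j one
      home-offset : toℕ (sweeperOffset (t i) j) ≡ 0
      home-offset = trans (toℕ-sweeperOffset (t i) j) (sweeperMoves-waiting (t i) (toℕ j) (<⇒≤ t<jk))
      left-home : suc (toℕ (proj₂ left)) ≡ toℕ (proj₂ home)
      left-home = blockCol-consecutive j₀ (fromℕ k) j _ (begin
        suc (K * toℕ j₀ + toℕ (fromℕ k)) ≡⟨ cong (λ x → suc (K * toℕ j₀ + x)) (toℕ-fromℕ k) ⟩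
        suc (K * toℕ j₀ + k)             ≡⟨ cong suc (+-comm _ k) ⟩
        K + K * toℕ j₀                   ≡⟨ *-suc K (toℕ j₀) ⟨
        K * suc (toℕ j₀)                 ≡⟨ +-identityʳ _ ⟨
        K * suc (toℕ j₀) + 0             ≡⟨ cong₂ (λ x y → K * x + y) j≡1+j₀ home-offset ⟨
        K * toℕ j + toℕ (sweeperOffset (t i) j) ∎)
      home-right : suc (toℕ (proj₂ home)) ≡ toℕ (proj₂ right)
      home-right = blockCol-consecutive j _ j one (begin
        suc (K * toℕ j + toℕ (sweeperOffset (t i) j)) ≡⟨ cong (λ x → suc (K * toℕ j + x)) home-offset ⟩
        suc (K * toℕ j + 0)                           ≡⟨ +-suc _ 0 ⟨
        K * toℕ j + 1                                 ≡⟨ cong (K * toℕ j +_) (toℕ-fromℕ< (s≤s k≥1)) ⟨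
        K * toℕ j + toℕ one                           ∎)
      left-adj : Graph.adj Big home left ≡ true
      left-adj = grid-adj-horizontal i _ _ (inj₂ left-home)
      right-adj : Graph.adj Big home right ≡ true
      right-adj = grid-adj-horizontal i _ _ (inj₁ home-right)
      left-unswept : protᴱ c₁ t left ≡ false
      left-unswept rewrite prot-block c₁ t i j₀ (fromℕ k) | toℕ-fromℕ k
                         | ≢⇒≡ᵇ≡false {k} {0} (λ k≡0 → <-irrefl (sym k≡0) k≥1) =
        >⇒≤ᵇ≡false (subst (t i <_) (trans (cong (_* k) j≡1+j₀) (+-comm k _)) t<jk)
      right-unswept : protᴱ c₁ t right ≡ false
      right-unswept rewrite prot-block c₁ t i j one | toℕ-fromℕ< (s≤s k≥1) = >⇒≤ᵇ≡false (≤-trans t<jk (m≤m+n _ 1))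
      unprotected : ∀ {u} → Graph.adj Big home u ≡ true → protᴱ c₁ t u ≡ false → T (BP.unprotᵇ C home u)
      unprotected {u} a p = ≡true⇒T (cong₂ (λ x y → x ∧ not y) a p)
      left≢right : left ≢ right
      left≢right e = <-irrefl (cong (toℕ ∘ proj₂) e)
        (≤-trans (≤-reflexive left-home) (≤-trans (n≤1+n _) (≤-reflexive home-right)))

    sweeper-moves⇒active : ∀ i j → T (B.moves C (sweeper i j)) → Active (t i) (toℕ j)
    sweeper-moves⇒active i j mv = started , sweeperMoves<k⇒ (t i) (toℕ j) unfinished
      where
      unfinished : sweeperMoves (t i) (toℕ j) < k
      unfinished = <ᵇ⇒< _ _ (subst T (cong (_<ᵇ k) (cnt-sweeper c₁ t i j)) (T-∧ˡ mv))
      fires-home : T (B.fires C (sweeperVertex t i j))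
      fires-home = subst T (cong (B.fires C) (pos-sweeper c₁ t i j)) (T-∧ʳ {B.mobile C (sweeper i j)} mv)
      started : toℕ j * k ≤ t i
      started with toℕ j * k ≤? t i
      ... | yes jk≤t = jk≤t
      ... | no  jk≰t = ⊥-elim (subst T (waiting-sweeper-idle i j (≰⇒> jk≰t)) fires-home)

    module ActiveSweeper (i : Fin m) (j : Fin q) (active : Active (t i) (toℕ j)) where
      offset : ℕ
      offset = t i ∸ toℕ j * k

      jk+offset≡t : toℕ j * k + offset ≡ t i
      jk+offset≡t = m+[n∸m]≡n (proj₁ active)

      offset<k : offset < k
      offset<k = +-cancelˡ-< (toℕ j * k) offset k (subst (_< toℕ j * k + k) (sym jk+offset≡t) (proj₂ active))

      toℕ-sweeperOffset-active : toℕ (sweeperOffset (t i) j) ≡ offset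
      toℕ-sweeperOffset-active = trans (toℕ-sweeperOffset (t i) j) (sweeperMoves-active (t i) (toℕ j) active)

      home next : Fin m × Fin n
      home = sweeperVertex t i j
      next = i , blockCol j (fromℕ< (s≤s offset<k))

      home-next : suc (toℕ (proj₂ home)) ≡ toℕ (proj₂ next)
      home-next = blockCol-consecutive j _ j _ (begin
        suc (K * toℕ j + toℕ (sweeperOffset (t i) j)) ≡⟨ cong (λ x → suc (K * toℕ j + x)) toℕ-sweeperOffset-active ⟩
        suc (K * toℕ j + offset)                      ≡⟨ +-suc _ offset ⟨
        K * toℕ j + suc offset                        ≡⟨ cong (K * toℕ j +_) (toℕ-fromℕ< (s≤s offset<k)) ⟨
        K * toℕ j + toℕ (fromℕ< (s≤s offset<k))      ∎)
        where open ≡-Reasoning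

      adj-next : Graph.adj Big home next ≡ true
      adj-next = grid-adj-horizontal i _ _ (inj₁ home-next)

      next-unswept : protᴱ c₁ t next ≡ false
      next-unswept rewrite prot-block c₁ t i j (fromℕ< (s≤s offset<k)) | toℕ-fromℕ< (s≤s offset<k) =
        >⇒≤ᵇ≡false (≤-reflexive (trans (cong suc (sym jk+offset≡t)) (sym (+-suc _ offset))))

      unprot-next : T (BP.unprotᵇ C home next)
      unprot-next = ≡true⇒T (cong₂ (λ x y → x ∧ not y) adj-next next-unswept)

  sweeperVertex-cong : ∀ t t′ i j → sweeperMoves (t′ i) (toℕ j) ≡ sweeperMoves (t i) (toℕ j) →
                       sweeperVertex t′ i j ≡ sweeperVertex t i j
  sweeperVertex-cong t t′ i j e = cong (λ r → i , blockCol j r)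
    (toℕ-injective (trans (toℕ-sweeperOffset (t′ i) j) (trans e (sym (toℕ-sweeperOffset (t i) j)))))

  advance : S.Config d₁ → (Fin m → ℕ) → Fin m → ℕ
  advance c₁ t i = if someFin (λ j → B.moves (extend c₁ t) (sweeper i j)) then suc (t i) else t i

  module _ (c₁ : S.Config d₁) (t : Fin m → ℕ) where
    private
      C = extend c₁ t

    advance-moving : ∀ i j → T (B.moves C (sweeper i j)) → advance c₁ t i ≡ suc (t i)
    advance-moving i j mv rewrite someFin-intro (λ j → B.moves C (sweeper i j)) j mv = refl

    advance-cases : ∀ i → advance c₁ t i ≡ t i ⊎ ∃ λ j → T (B.moves C (sweeper i j))
    advance-cases i with search (λ j → B.moves C (sweeper i j))
    ... | inj₁ moving = inj₂ moving
    ... | inj₂ none rewrite someFin-false _ none = inj₁ refl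

    advance-≡⊎≡suc : ∀ i → advance c₁ t i ≡ t i ⊎ advance c₁ t i ≡ suc (t i)
    advance-≡⊎≡suc i with advance-cases i
    ... | inj₁ same      = inj₁ same
    ... | inj₂ (j , mv)  = inj₂ (advance-moving i j mv)

    sweeperMoves-advance-idle : ∀ i j → ¬ T (B.moves C (sweeper i j)) →
                                sweeperMoves (advance c₁ t i) (toℕ j) ≡ sweeperMoves (t i) (toℕ j)
    sweeperMoves-advance-idle i j idle with advance-cases i
    ... | inj₁ same       = cong (λ x → sweeperMoves x (toℕ j)) same
    ... | inj₂ (j′ , mv′) = trans (cong (λ x → sweeperMoves x (toℕ j)) (advance-moving i j′ mv′))
        (sweeperMoves-suc-inactive (t i) (toℕ j) (toℕ j′) j≢j′ (sweeper-moves⇒active c₁ t i j′ mv′))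
      where
      j≢j′ : toℕ j ≢ toℕ j′
      j≢j′ e with toℕ-injective e
      ... | refl = idle mv′

    module MovingSweeper (c₁′ : S.Config d₁) (i : Fin m) (j : Fin q) (mv : T (B.moves C (sweeper i j))) where
      open ActiveSweeper c₁ t i j (sweeper-moves⇒active c₁ t i j mv) public

      sweeperMoves-advance : sweeperMoves (advance c₁ t i) (toℕ j) ≡ suc (sweeperMoves (t i) (toℕ j))
      sweeperMoves-advance rewrite advance-moving i j mv =
        sweeperMoves-suc-active (t i) (toℕ j) (sweeper-moves⇒active c₁ t i j mv)

      pos-advance : posᴱ c₁′ (advance c₁ t) (sweeper i j) ≡ next
      pos-advance = trans (pos-sweeper c₁′ (advance c₁ t) i j) (sweeperVertex≡block⇐ c₁′ (advance c₁ t) i j _ (begin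
        sweeperMoves (advance c₁ t i) (toℕ j) ≡⟨ sweeperMoves-advance ⟩
        suc (sweeperMoves (t i) (toℕ j))      ≡⟨ cong suc (trans (sym (toℕ-sweeperOffset (t i) j)) toℕ-sweeperOffset-active) ⟩
        suc offset                            ≡⟨ toℕ-fromℕ< (s≤s offset<k) ⟨
        toℕ (fromℕ< (s≤s offset<k))          ∎))
        where open ≡-Reasoning

  module StepSimulation {c₁ c₁′ : S.Config d₁} (st : S.Step c₁ c₁′) (t : Fin m → ℕ) where
    private
      C  = extend c₁ t
      t′ = advance c₁ t
      C′ = extend c₁′ t′
      module St = S.Step st

    moveOK : ∀ x → T (B.moves C x) →
             (Graph.adj Big (posᴱ c₁ t x) (posᴱ c₁′ t′ x) ≡ true) × (protᴱ c₁ t (posᴱ c₁′ t′ x) ≡ false)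
             × (cntᴱ c₁′ t′ x ≡ suc (cntᴱ c₁ t x))
    moveOK x mv with searcherView x
    ... | is-small a with St.moveOK a (subst T (moves-small c₁ t a) mv)
    ...   | adjS , unprotS , cntS =
      trans (cong₂ (Graph.adj Big) (pos-small c₁ t a) (pos-small c₁′ t′ a)) (trans (adj-embed (S.pos c₁ a) (S.pos c₁′ a)) adjS) ,
      trans (cong (protᴱ c₁ t) (pos-small c₁′ t′ a)) (trans (prot-embed c₁ t _) unprotS) ,
      trans (cnt-small c₁′ t′ a) (trans cntS (cong suc (sym (cnt-small c₁ t a))))
    moveOK x mv | is-sweeper i j =
      trans (cong₂ (Graph.adj Big) (pos-sweeper c₁ t i j) pos-advance) adj-next ,
      trans (cong (protᴱ c₁ t) pos-advance) next-unswept ,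
      trans (cnt-sweeper c₁′ t′ i j) (trans sweeperMoves-advance (cong suc (sym (cnt-sweeper c₁ t i j))))
      where open MovingSweeper c₁ t c₁′ i j mv

    stayOK : ∀ x → ¬ T (B.moves C x) → (posᴱ c₁′ t′ x ≡ posᴱ c₁ t x) × (cntᴱ c₁′ t′ x ≡ cntᴱ c₁ t x)
    stayOK x idle with searcherView x
    ... | is-small a with St.stayOK a (idle ∘ subst T (sym (moves-small c₁ t a)))
    ...   | posS , cntS = trans (pos-small c₁′ t′ a) (trans (cong embed posS) (sym (pos-small c₁ t a))) ,
                          trans (cnt-small c₁′ t′ a) (trans cntS (sym (cnt-small c₁ t a)))
    stayOK x idle | is-sweeper i j =
      trans (pos-sweeper c₁′ t′ i j) (trans (sweeperVertex-cong t t′ i j same) (sym (pos-sweeper c₁ t i j))) ,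
      trans (cnt-sweeper c₁′ t′ i j) (trans same (sym (cnt-sweeper c₁ t i j)))
      where
      same : sweeperMoves (t′ i) (toℕ j) ≡ sweeperMoves (t i) (toℕ j)
      same = sweeperMoves-advance-idle c₁ t i j idle

    Covered : Fin m × Fin n → Fin m × Fin n → Set
    Covered v u = ∃ λ x → (posᴱ c₁ t x ≡ v) × T (B.mobile C x) × (posᴱ c₁′ t′ x ≡ u)

    cover-small : ∀ a u → T (B.fires C (posᴱ c₁ t (small a))) → Graph.adj Big (posᴱ c₁ t (small a)) u ≡ true →
                  protᴱ c₁ t u ≡ false → Covered (posᴱ c₁ t (small a)) u
    cover-small a u fv adj unprot rewrite pos-small c₁ t a with vertexView u
    ... | is-block i j r with trans (sym (block-next-to-embed-protected c₁ t (S.pos c₁ a) i j r adj)) unprot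
    ...   | ()
    cover-small a u fv adj unprot | is-embedded w
      with St.cover (S.pos c₁ a) w (subst T (fires-embed c₁ t _) fv) (trans (sym (adj-embed _ w)) adj)
                    (trans (sym (prot-embed c₁ t w)) unprot)
    ... | a′ , pa , ma , pa′ =
      small a′ , trans (pos-small c₁ t a′) (cong embed pa) , subst T (cong (_<ᵇ k) (sym (cnt-small c₁ t a′))) ma ,
      trans (pos-small c₁′ t′ a′) (cong embed pa′)

    module _ (i : Fin m) (j : Fin q) (mob : T (B.mobile C (sweeper i j))) (fv : T (B.fires C (posᴱ c₁ t (sweeper i j)))) where
      open MovingSweeper c₁ t c₁′ i j (T-∧⁺ mob fv)

      cover-sweeper : ∀ u → Graph.adj Big (posᴱ c₁ t (sweeper i j)) u ≡ true → protᴱ c₁ t u ≡ false →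
                      posᴱ c₁′ t′ (sweeper i j) ≡ u
      cover-sweeper u adj unprot with Graph._≟V_ Big u next
      ... | yes refl    = pos-advance
      ... | no  u≢next  = ⊥-elim (subst T two-unprotected (subst T (cong (B.fires C) (pos-sweeper c₁ t i j)) fv))
        where
        unprot-u : T (BP.unprotᵇ C home u)
        unprot-u = ≡true⇒T (cong₂ (λ x y → x ∧ not y) (trans (cong (λ w → Graph.adj Big w u) (sym (pos-sweeper c₁ t i j))) adj) unprot)
        two-unprotected : B.fires C home ≡ false
        two-unprotected = BP.fires≡false-two-unprotected C home u next (grid-verts-complete u) (grid-verts-complete next)
                            u≢next unprot-u unprot-next (mobileAt-block≤1 c₁ t i j _)

    cover : ∀ v u → T (B.fires C v) → Graph.adj Big v u ≡ true → protᴱ c₁ t u ≡ false → Covered v u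
    cover v u fv adj unprot with count-pos⇒∃ _ (≤-trans (proj₁ (BP.fires⇒ C v fv)) (proj₂ (BP.fires⇒ C v fv)))
    ... | x , tx with BP.eqV⇒≡ {posᴱ c₁ t x} {v} (T-∧ˡ tx) | T-∧ʳ {B.eqV (posᴱ c₁ t x) v} tx
    ... | refl | mob with searcherView x
    ...   | is-small a     = cover-small a u fv adj unprot
    ...   | is-sweeper i j = sweeper i j , refl , mob , cover-sweeper i j mob fv u adj unprot

    protOK : ∀ u → protᴱ c₁′ t′ u ≡ (protᴱ c₁ t u ∨ someFin (λ x → B.eqV (posᴱ c₁′ t′ x) u))
    protOK u with vertexView u
    ... | is-embedded v = trans (prot-embed c₁′ t′ v) (trans (St.protOK v)
                            (sym (cong₂ _∨_ (prot-embed c₁ t v) (occupied-embed c₁′ t′ v))))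
    ... | is-block i j r = trans (prot-block c₁′ t′ i j r)
                             (trans (sweptᵇ-step (t i) (t′ i) (toℕ j) (toℕ r) (≤-pred (toℕ<n r)) (advance-≡⊎≡suc c₁ t i))
                               (sym (cong₂ _∨_ (prot-block c₁ t i j r) (occupied-block c₁′ t′ i j r))))

    step : B.Step C C′
    step = record { moveOK = moveOK ; stayOK = stayOK ; cover = cover ; protOK = protOK }

  -- Once the small grid is fully protected, the least advanced row can always move: the rows next to
  -- it are at least as far, so its active sweeper has a single unprotected neighbour.
  module _ (c₁ : S.Config d₁) (done : ∀ v → S.prot c₁ v ≡ true) (t : Fin m → ℕ) where
    private
      C = extend c₁ t

    swept⇒protected : ∀ i j r → toℕ j * k + toℕ r ≤ t i → protᴱ c₁ t (i , blockCol j r) ≡ true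
    swept⇒protected i j r le rewrite prot-block c₁ t i j r | ≤⇒≤ᵇ≡true le = ∨-zeroʳ _

    least-row-moves : ∀ i → (∀ i′ → t i ≤ t i′) → ∀ j → Active (t i) (toℕ j) → T (B.moves C (sweeper i j))
    least-row-moves i least j active = T-∧⁺ mob (subst T (cong (B.fires C) (sym (pos-sweeper c₁ t i j))) (≡true⇒T fires-home))
      where
      open ActiveSweeper c₁ t i j active
      mob : T (B.mobile C (sweeper i j))
      mob = subst T (cong (_<ᵇ k) (sym (trans (cnt-sweeper c₁ t i j) (sweeperMoves-active (t i) (toℕ j) active)))) (<⇒<ᵇ offset<k)
      at-home : T (B.eqV (posᴱ c₁ t (sweeper i j)) home)
      at-home = ≡true⇒T (trans (cong (λ u → B.eqV u home) (pos-sweeper c₁ t i j)) (BP.eqV-refl home))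
      ¬unprotected-protected : ∀ {u} → T (BP.unprotᵇ C home u) → protᴱ c₁ t u ≢ true
      ¬unprotected-protected {u} tu p with trans (sym p) (T-not⇒≡false (T-∧ʳ {Graph.adj Big home u} tu))
      ... | ()
      only-next : ∀ u → T (BP.unprotᵇ C home u) → u ≡ next
      only-next u tu with vertexView u
      ... | is-embedded v = ⊥-elim (¬unprotected-protected tu (trans (prot-embed c₁ t v) (done v)))
      ... | is-block i′ j′ r′ with grid-adj⇒ i (blockCol j _) i′ (blockCol j′ r′) (T⇒≡true (T-∧ˡ tu))
      ...   | inj₁ (same-col , _) with blockCol-injective (toℕ-injective same-col)
      ...     | refl , refl = ⊥-elim (¬unprotected-protected tu (swept⇒protected i′ j _
                 (subst (_≤ t i′) (trans (sym jk+offset≡t) (cong (toℕ j * k +_) (sym toℕ-sweeperOffset-active))) (least i′))))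
      only-next u tu | is-block i′ j′ r′ | inj₂ (refl , inj₁ right) = cong (i ,_) (toℕ-injective (trans (sym right) home-next))
      only-next u tu | is-block i′ j′ r′ | inj₂ (refl , inj₂ left) = ⊥-elim (¬unprotected-protected tu (swept⇒protected i j′ r′
        (≤-trans (left-neighbour-swept-no-later (toℕ j) (toℕ j′) (toℕ r′) offset (≤-pred (toℕ<n r′)) (m≤n⇒m≤1+n offset<k)
                   (trans (blockCol-consecutive⁻¹ j′ r′ j _ left) (cong (λ x → K * toℕ j + x) toℕ-sweeperOffset-active)))
                 (≤-reflexive jk+offset≡t))))
      fires-home : B.fires C home ≡ true
      fires-home = BP.fires≡true-single-unprotected C home next (grid-verts-complete next) grid-verts-unique
                     unprot-next only-next (count-pos _ {sweeper i j} (T-∧⁺ at-home mob))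

  Bounded : (Fin m → ℕ) → Set
  Bounded t = ∀ i → t i ≤ q * k

  module _ (c₁ : S.Config d₁) (t : Fin m → ℕ) where
    advance-mono : ∀ i → t i ≤ advance c₁ t i
    advance-mono i with advance-≡⊎≡suc c₁ t i
    ... | inj₁ same = ≤-reflexive (sym same)
    ... | inj₂ next = subst (t i ≤_) (sym next) (n≤1+n _)

    advance-bounded : Bounded t → Bounded (advance c₁ t)
    advance-bounded bounded i with advance-cases c₁ t i
    ... | inj₁ same     = subst (_≤ q * k) (sym same) (bounded i)
    ... | inj₂ (j , mv) = subst (_≤ q * k) (sym (advance-moving c₁ t i j mv)) (<-≤-trans (proj₂ (sweeper-moves⇒active c₁ t i j mv))
                            (≤-trans (≤-reflexive (+-comm _ k)) (*-monoˡ-≤ k (toℕ<n j))))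

  simulate : ∀ {c₁ c₁′} → Star S.Step c₁ c₁′ → ∀ t → Bounded t →
             ∃ λ t′ → Star B.Step (extend c₁ t) (extend c₁′ t′) × Bounded t′
  simulate ε          t bounded = t , ε , bounded
  simulate (st ◅ run) t bounded with simulate run _ (advance-bounded _ t bounded)
  ... | t′ , run′ , bounded′ = t′ , StepSimulation.step st t ◅ run′ , bounded′

  module _ (c₁ : S.Config d₁) (done : ∀ v → S.prot c₁ v ≡ true) where

    -- a row that is d + 1 but not d moves from the end is least advanced, so it moves
    advance-level : ∀ d t → (∀ i → q * k ≤ suc d + t i) → ∀ i → q * k ≤ d + advance c₁ t i
    advance-level d t level i with q * k ≤? d + t i
    ... | yes ahead  = ≤-trans ahead (+-monoʳ-≤ d (advance-mono c₁ t i))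
    ... | no  behind = subst (q * k ≤_) (sym (trans (cong (d +_) (advance-moving c₁ t i j mv)) (+-suc d (t i)))) (level i)
      where
      least : ∀ i′ → t i ≤ t i′
      least i′ = +-cancelˡ-≤ d _ _ (≤-pred (<-≤-trans (≰⇒> behind) (level i′)))
      active = activeBlock q (t i) (≤-<-trans (m≤n+m (t i) d) (≰⇒> behind))
      j = proj₁ active
      mv = least-row-moves c₁ done t i least j (proj₂ active)

    finish : ∀ d t → Bounded t → (∀ i → q * k ≤ d + t i) →
             ∃ λ t′ → Star B.Step (extend c₁ t) (extend c₁ t′) × (∀ i → q * k ≤ t′ i)
    finish zero    t _       level = t , ε , level
    finish (suc d) t bounded level with finish d (advance c₁ t) (advance-bounded c₁ t bounded) (advance-level d t level)
    ... | t′ , run , done′ = t′ , StepSimulation.step (SP.idle c₁ done) t ◅ run , done′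

    finished-protected : ∀ t → (∀ i → q * k ≤ t i) → ∀ v → protᴱ c₁ t v ≡ true
    finished-protected t finished v with vertexView v
    ... | is-embedded w  = trans (prot-embed c₁ t w) (done w)
    ... | is-block i j r = swept⇒protected c₁ done t i j r (begin
      toℕ j * k + toℕ r ≤⟨ +-monoʳ-≤ (toℕ j * k) (≤-pred (toℕ<n r)) ⟩
      toℕ j * k + k     ≡⟨ +-comm _ k ⟩
      suc (toℕ j) * k   ≤⟨ *-monoˡ-≤ k (toℕ<n j) ⟩
      q * k             ≤⟨ finished i ⟩
      t i               ∎)
      where open ≤-Reasoning

  module _ (L₁ : Fin d₁ → Fin m × Fin n₁) where
    private
      c₁ = S.initial L₁
      t₀ : Fin m → ℕ
      t₀ _ = 0

    layout : Fin #searchers → Fin m × Fin n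
    layout = posᴱ c₁ t₀

    initial≈extend : B.initial layout BP.≈ extend c₁ t₀
    initial≈extend = record { pos≈ = λ _ → refl ; cnt≈ = cnt≈ ; prot≈ = prot≈ }
      where
      cnt≈ : ∀ x → 0 ≡ cntᴱ c₁ t₀ x
      cnt≈ x with searcherView x
      ... | is-small a     = sym (cnt-small c₁ t₀ a)
      ... | is-sweeper i j = sym (trans (cnt-sweeper c₁ t₀ i j) (sweeperMoves-waiting 0 (toℕ j) z≤n))
      prot≈ : ∀ v → someFin (λ x → B.eqV (layout x) v) ≡ protᴱ c₁ t₀ v
      prot≈ v with vertexView v
      ... | is-embedded w  = trans (occupied-embed c₁ t₀ w) (sym (prot-embed c₁ t₀ w))
      ... | is-block i j r = trans (occupied-block c₁ t₀ i j r)
                               (trans (sym (sweptᵇ-initial (toℕ j) (toℕ r))) (sym (prot-block c₁ t₀ i j r)))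

    layout-successful : S.Successful L₁ → B.Successful layout
    layout-successful (c₁′ , run₁ , done) with simulate run₁ t₀ (λ _ → z≤n)
    ... | t , run , bounded with finish c₁′ done (q * k) t bounded (λ i → m≤m+n _ (t i))
    ... | t′ , run′ , finished with BP.Star-respˡ-≈ initial≈extend (run ◅◅ run′)
    ... | c , run″ , c≈ = c , run″ , λ v → trans (BP._≈_.prot≈ c≈ v) (finished-protected c₁′ done t′ finished v)

dk-grid≤ : ∀ k → 1 ≤ k → ∀ m n₁ q {d d₁} → dk≡ k (grid m (n₁ + q * suc k)) d → dk≡ k (grid m n₁) d₁ → d ≤ d₁ + m * q
dk-grid≤ k k≥1 m n₁ q (_ , minimal) ((L₁ , success₁) , _) =
  minimal _ (Sweep.layout k k≥1 m n₁ q _ L₁) (Sweep.layout-successful k k≥1 m n₁ q _ L₁ success₁)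

dk-grid≥ : ∀ k m n {d} → dk≡ k (grid m n) d → m * n ≤ d * suc k
dk-grid≥ k m n ((L , success) , _) = successful⇒grid-bound k m n L success

lemma4p7 : (k m n : ℕ) → 1 ≤ k → 1 ≤ m → k + 1 < n →
           (n₁ n₂ : ℕ) → 1 ≤ n₁ → 1 ≤ n₂ → n₁ + n₂ ≡ n → (k + 1) ∣ n₂ →
           (d d₁ d₂ : ℕ) → dk≡ k (grid m n) d → dk≡ k (grid m n₁) d₁ → dk≡ k (grid m n₂) d₂ →
           d ≤ d₁ + d₂
lemma4p7 k m n k≥1 _ _ n₁ n₂ _ _ n₁+n₂≡n (divides q n₂≡q[k+1]) d d₁ d₂ dk-n dk-n₁ dk-n₂ =
  ≤-trans (dk-grid≤ k k≥1 m n₁ q (subst (λ N → dk≡ k (grid m N) d) n≡n₁+qK dk-n) dk-n₁) (+-monoʳ-≤ d₁ mq≤d₂)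
  where
  n₂≡qK : n₂ ≡ q * suc k
  n₂≡qK = trans n₂≡q[k+1] (cong (q *_) (+-comm k 1))
  n≡n₁+qK : n ≡ n₁ + q * suc k
  n≡n₁+qK = trans (sym n₁+n₂≡n) (cong (n₁ +_) n₂≡qK)
  mq≤d₂ : m * q ≤ d₂
  mq≤d₂ = *-cancelʳ-≤ (m * q) d₂ (suc k) (begin
    m * q * suc k     ≡⟨ *-assoc m q (suc k) ⟩
    m * (q * suc k)   ≡⟨ cong (m *_) n₂≡qK ⟨
    m * n₂            ≤⟨ dk-grid≥ k m n₂ dk-n₂ ⟩
    d₂ * suc k        ∎)
    where open ≤-Reasoning
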